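{- Over Bishop-style constructive mathematics, the following two principles are equivalent: (UC$_c$) Every function $f\colon\{0,1\}^{\mathbb{N}}\to\mathbb{N}$ that has a continuous modulus is uniformly continuous. (UCT$_c^{2^{\mathbb{N}}}$) Every continuous function $f\colon\{0,1\}^{\mathbb{N}}\to\mathbb{R}$ that has a continuous modulus is uniformly continuous.
   Context: The setting is constructive (intuitionistic, Bishop-style). For $\alpha\in\{0,1\}^{\mathbb{N}}$, $\overline{\alpha}n$ denotes its initial segment of length $n$. Continuity for $f\colon\{0,1\}^{\mathbb{N}}\to\mathbb{N}$: - $f$ is pointwise continuous if $\forall\alpha\,\exists n\,\forall\beta\,(\overline{\alpha}n=\overline{\beta}n\to f(\alpha)=f(\beta))$. - $f$ is uniformly continuous if $\exists n\,\forall\alpha,\beta\,(\overline{\alpha}n=\overline{\beta}n\to f(\alpha)=f(\beta))$. - A modulus of $f$ is a function $g\colon\{0,1\}^{\mathbb{N}}\to\mathbb{N}$ with $\forall\alpha,\beta\,(\overline{\alpha}g(\alpha)=\overline{\beta}g(\alpha)\to f(\alpha)=f(\beta))$. - The modulus is continuous if $g$ is pointwise continuous. Continuity for $f\colon\{0,1\}^{\mathbb{N}}\to\mathbb{R}$ (real numbers as Cauchy/regular sequences of rationals with constructive equality): - $f$ is pointwise continuous if $\forall\alpha\,\forall k\,\exists n\,\forall\beta\,(\overline{\alpha}n=\overline{\beta}n\to|f(\alpha)-f(\beta)|\le 2^{ -k})$. - $f$ is uniformly continuous if there is $\omega\colon\mathbb{N}\to\mathbb{N}$ with $\forall k\,\forall\alpha,\beta\,(\overline{\alpha}\omega(k)=\overline{\beta}\omega(k)\to|f(\alpha)-f(\beta)|\le2^{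 -k})$. - A modulus of $f$ is $g\colon\mathbb{N}\to\{0,1\}^{\mathbb{N}}\to\mathbb{N}$, written $g_k(\alpha)$, with $\forall k\,\forall\alpha,\beta\,(\overline{\alpha}g_k(\alpha)=\overline{\beta}g_k(\alpha)\to|f(\alpha)-f(\beta)|\le 2^{ -k})$. - The modulus is continuous if each $g_k\colon\{0,1\}^{\mathbb{N}}\to\mathbb{N}$ is pointwise continuous. -}

module Defs where

open import Data.Bool using (Bool)
open import Data.Nat as ℕ using (ℕ; suc; _<_; _^_; _*_)
open import Data.Nat.Properties using (m^n≢0)
open import Data.Integer using (+_)
open import Data.Rational using (ℚ; _/_; _-_; _+_; _≤_; ∣_∣)
open import Data.Product using (Σ; _×_)
open import Relation.Binary.PropositionalEquality using (_≡_)

Cantor : Set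
Cantor = ℕ → Bool

InitEq : ℕ → Cantor → Cantor → Set
InitEq n α β = ∀ i → i < n → α i ≡ β i

PointwiseContinuousℕ : (Cantor → ℕ) → Set
PointwiseContinuousℕ f =
  ∀ α → Σ ℕ λ n → ∀ β → InitEq n α β → f α ≡ f β

UniformlyContinuousℕ : (Cantor → ℕ) → Set
UniformlyContinuousℕ f =
  Σ ℕ λ n → ∀ α β → InitEq n α β → f α ≡ f β

IsModulusℕ : (Cantor → ℕ) → (Cantor → ℕ) → Set
IsModulusℕ f g = ∀ α β → InitEq (g α) α β → f α ≡ f β

-- Bishop real numbers: regular sequences of rationals.
-- seq i stands for Bishop's x_{i+1} (indices start at 1).

1/suc : ℕ → ℚ
1/suc i = + 1 / suc i

record ℝ : Set where
  field
    seq : ℕ → ℚ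
    reg : ∀ i j → ∣ seq i - seq j ∣ ≤ 1/suc i + 1/suc j
open ℝ public

2^-_ : ℕ → ℚ
2^- k = _/_ (+ 1) (2 ^ k) {{m^n≢0 2 k}}

-- |x - y| ≤ q for reals x, y and rational q (as the constant real),
-- unfolded from Bishop's definitions:
--   (|x - y|)_n = |x_{2n} - y_{2n}|,   a ≤ b  iff  ∀ n ≥ 1, a_n ≤ b_n + 2/n.
-- With n = suc i, Bishop index 2n corresponds to seq-index suc (2 * i).
DistLe : ℝ → ℝ → ℚ → Set
DistLe x y q =
  ∀ i → ∣ seq x (suc (2 * i)) - seq y (suc (2 * i)) ∣ ≤ q + (+ 2 / suc i)

PointwiseContinuousℝ : (Cantor → ℝ) → Set
PointwiseContinuousℝ f =
  ∀ α k → Σ ℕ λ n → ∀ β → InitEq n α β → DistLe (f α) (f β) (2^- k)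

UniformlyContinuousℝ : (Cantor → ℝ) → Set
UniformlyContinuousℝ f =
  Σ (ℕ → ℕ) λ ω → ∀ k α β → InitEq (ω k) α β → DistLe (f α) (f β) (2^- k)

IsModulusℝ : (Cantor → ℝ) → (ℕ → Cantor → ℕ) → Set
IsModulusℝ f g =
  ∀ k α β → InitEq (g k α) α β → DistLe (f α) (f β) (2^- k)

UCc : Set
UCc = ∀ (f : Cantor → ℕ) →
  Σ (Cantor → ℕ) (λ g → IsModulusℕ f g × PointwiseContinuousℕ g) →
  UniformlyContinuousℕ f

UCTc : Set
UCTc = ∀ (f : Cantor → ℝ) → PointwiseContinuousℝ f →
  Σ (ℕ → Cantor → ℕ) (λ g → IsModulusℝ f g × (∀ k → PointwiseContinuousℕ (g k))) →
  UniformlyContinuousℝ f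

{-# OPTIONS --safe #-}

-- Let G be a continuous modulus of f at precision 2^-(k+1), and let μ α be the least n
-- with G (ᾱn) ≤ n (ᾱn padded with false). Whether n qualifies depends only on ᾱn, so
-- μ is its own continuous modulus; UC_c makes it uniformly continuous, hence bounded by
-- some M. Any α, β that agree up to M both lie in the G-neighbourhood of γ = ᾱ(μ α),
-- so |f α - f β| ≤ 2 · 2^-(k+1). Conversely, a ℕ-valued function with a continuous
-- modulus is a real-valued one through the constant embedding, and naturals at
-- distance at most 1/2 are equal.
module Submission where

open import Defs
open import Data.Product using (Σ; _×_; _,_; proj₁; proj₂)
open import Relation.Binary.PropositionalEquality

module BishopDistance where

  open import Data.Nat as ℕ using (ℕ; suc; NonZero)
  open import Data.Nat.Properties using (m^n≢0; m*n≢0; +-identityʳ)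
  open import Data.Nat.Tactic.RingSolver using (solve-∀)
  open import Data.Integer.Tactic.RingSolver using () renaming (solve-∀ to ℤ-solve-∀)
  open import Data.Integer as ℤ using (+_; +[1+_]; -[1+_])
  import Data.Integer.Properties as ℤ
  open import Data.Rational
    using (_/_; _+_; _-_; -_; _≤_; ∣_∣; 0ℚ; toℚᵘ)
  open import Data.Rational.Properties
    using ( fromℚᵘ-cong; toℚᵘ-fromℚᵘ; toℚᵘ-injective; toℚᵘ-mono-≤
          ; toℚᵘ-homo-+; toℚᵘ-homo‿-; toℚᵘ-homo-∣-∣
          ; normalize-nonNeg; nonNegative⁻¹; +-inverseʳ; +-mono-≤; +-monoʳ-≤
          ; ∣p+q∣≤∣p∣+∣q∣; ∣-p∣≡∣p∣; module ≤-Reasoning)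
  open import Data.Rational.Unnormalised as ℚᵘ using (mkℚᵘ)
  import Data.Rational.Unnormalised.Properties as ℚᵘ
  open import Data.Rational.Solver using (module +-*-Solver)
  open +-*-Solver using (solve; _:+_; _:-_; :-_; _:=_)

  +-/-cross : ∀ a b m n → a ℕ.* suc n ≡ b ℕ.* suc m → + a / suc m ≡ + b / suc n
  +-/-cross a b m n eq = fromℚᵘ-cong {mkℚᵘ (+ a) m} {mkℚᵘ (+ b) n} (ℚᵘ.*≡* (begin
    + a ℤ.* + suc n   ≡⟨ ℤ.pos-* a (suc n) ⟨
    + (a ℕ.* suc n)   ≡⟨ cong +_ eq ⟩
    + (b ℕ.* suc m)   ≡⟨ ℤ.pos-* b (suc m) ⟩
    + b ℤ.* + suc m   ∎))
    where open ≡-Reasoning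

  ℚᵘ-+-/-+ : ∀ a b d → mkℚᵘ (+ a) d ℚᵘ.+ mkℚᵘ (+ b) d ℚᵘ.≃ mkℚᵘ (+ (a ℕ.+ b)) d
  ℚᵘ-+-/-+ a b d = ℚᵘ.*≡* (begin
    (+ a ℤ.* s ℤ.+ + b ℤ.* s) ℤ.* s  ≡⟨ factor (+ a) (+ b) s ⟩
    (+ a ℤ.+ + b) ℤ.* (s ℤ.* s)      ≡⟨ cong₂ ℤ._*_ (ℤ.pos-+ a b) (ℤ.pos-* (suc d) (suc d)) ⟨
    + (a ℕ.+ b) ℤ.* + (suc d ℕ.* suc d) ∎)
    where
    open ≡-Reasoning
    s = + suc d
    factor : ∀ x y s → (x ℤ.* s ℤ.+ y ℤ.* s) ℤ.* s ≡ (x ℤ.+ y) ℤ.* (s ℤ.* s)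
    factor = ℤ-solve-∀

  +-/-+ : ∀ a b d → + a / suc d + + b / suc d ≡ + (a ℕ.+ b) / suc d
  +-/-+ a b d = toℚᵘ-injective (begin
    toℚᵘ (+ a / suc d + + b / suc d)
      ≈⟨ toℚᵘ-homo-+ (+ a / suc d) (+ b / suc d) ⟩
    toℚᵘ (+ a / suc d) ℚᵘ.+ toℚᵘ (+ b / suc d)
      ≈⟨ ℚᵘ.+-cong (toℚᵘ-fromℚᵘ â) (toℚᵘ-fromℚᵘ b̂) ⟩
    â ℚᵘ.+ b̂
      ≈⟨ ℚᵘ-+-/-+ a b d ⟩
    mkℚᵘ (+ (a ℕ.+ b)) d
      ≈⟨ toℚᵘ-fromℚᵘ (mkℚᵘ (+ (a ℕ.+ b)) d) ⟨
    toℚᵘ (+ (a ℕ.+ b) / suc d) ∎)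
    where
    open ℚᵘ.≃-Reasoning
    â = mkℚᵘ (+ a) d
    b̂ = mkℚᵘ (+ b) d

  half+half : ∀ m n → 2 ℕ.* suc n ≡ suc m → + 1 / suc m + + 1 / suc m ≡ + 1 / suc n
  half+half m n 2[n+1]≡m+1 =
    trans (+-/-+ 1 1 m) (+-/-cross 2 1 m n (trans 2[n+1]≡m+1 (sym (+-identityʳ (suc m)))))

  2^-suc+2^-suc : ∀ k → 2^- suc k + 2^- suc k ≡ 2^- k
  2^-suc+2^-suc k = halves (2 ℕ.^ k) {{m^n≢0 2 k}}
    where
    halves : ∀ n .{{_ : NonZero n}} →
             let instance _ = m*n≢0 2 n in + 1 / (2 ℕ.* n) + + 1 / (2 ℕ.* n) ≡ + 1 / n
    halves (suc n) = half+half _ n refl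

  -- Comparing at the finer index j = 5i + 4 makes the regularity errors
  -- fit the budget 2/(i+1) of DistLe exactly.
  regularityBudget : ∀ i → let j = 4 ℕ.+ 5 ℕ.* i
                               U = + 1 / suc (suc (2 ℕ.* i))
                               V = + 1 / suc (suc (2 ℕ.* j))
                               W = + 2 / suc j
                           in (U + U) + ((V + V) + (W + W)) ≡ + 2 / suc i
  regularityBudget i = begin
    (U + U) + ((V + V) + (W + W))
      ≡⟨ cong₂ _+_ (halves i) (cong₂ _+_ (halves j) (+-/-+ 2 2 j)) ⟩
    + 1 / suc i + (+ 1 / suc j + + 4 / suc j)
      ≡⟨ cong (_+_ (+ 1 / suc i)) (+-/-+ 1 4 j) ⟩
    + 1 / suc i + + 5 / suc j
      ≡⟨ cong (_+_ (+ 1 / suc i)) (+-/-cross 5 1 j i (5[n+1]≡5n+5 i)) ⟩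
    + 1 / suc i + + 1 / suc i
      ≡⟨ +-/-+ 1 1 i ⟩
    + 2 / suc i ∎
    where
    open ≡-Reasoning
    j = 4 ℕ.+ 5 ℕ.* i
    U = + 1 / suc (suc (2 ℕ.* i))
    V = + 1 / suc (suc (2 ℕ.* j))
    W = + 2 / suc j
    2[n+1]≡2n+2 : ∀ n → 2 ℕ.* suc n ≡ suc (suc (2 ℕ.* n))
    2[n+1]≡2n+2 = solve-∀
    halves : ∀ n → + 1 / suc (suc (2 ℕ.* n)) + + 1 / suc (suc (2 ℕ.* n)) ≡ + 1 / suc n
    halves n = half+half (suc (2 ℕ.* n)) n (2[n+1]≡2n+2 n)
    5[n+1]≡5n+5 : ∀ n → 5 ℕ.* suc n ≡ 1 ℕ.* suc (4 ℕ.+ 5 ℕ.* n)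
    5[n+1]≡5n+5 = solve-∀

  ∣p-r∣≤∣p-q∣+∣q-r∣ : ∀ p q r → ∣ p - r ∣ ≤ ∣ p - q ∣ + ∣ q - r ∣
  ∣p-r∣≤∣p-q∣+∣q-r∣ p q r =
    subst (_≤ ∣ p - q ∣ + ∣ q - r ∣) (cong ∣_∣ (telescope p q r))
          (∣p+q∣≤∣p∣+∣q∣ (p - q) (q - r))
    where
    telescope : ∀ p q r → (p - q) + (q - r) ≡ p - r
    telescope = solve 3 (λ p q r → (p :- q) :+ (q :- r) := p :- r) refl

  DistLe-sym : ∀ x y q → DistLe x y q → DistLe y x q
  DistLe-sym x y q x~y i =
    subst (_≤ q + + 2 / suc i) (trans (sym (∣-p∣≡∣p∣ (xᵢ - yᵢ))) (cong ∣_∣ (negate xᵢ yᵢ)))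
          (x~y i)
    where
    xᵢ = seq x (suc (2 ℕ.* i))
    yᵢ = seq y (suc (2 ℕ.* i))
    negate : ∀ p q → - (p - q) ≡ q - p
    negate = solve 2 (λ p q → :- (p :- q) := q :- p) refl

  DistLe-trans : ∀ x y z a b → DistLe x y a → DistLe y z b → DistLe x z (a + b)
  DistLe-trans x y z a b x~y y~z i = begin
    ∣ X p - Z p ∣
      ≤⟨ ∣p-r∣≤∣p-q∣+∣q-r∣ (X p) (X q) (Z p) ⟩
    ∣ X p - X q ∣ + ∣ X q - Z p ∣
      ≤⟨ +-monoʳ-≤ ∣ X p - X q ∣ (∣p-r∣≤∣p-q∣+∣q-r∣ (X q) (Y q) (Z p)) ⟩
    ∣ X p - X q ∣ + (∣ X q - Y q ∣ + ∣ Y q - Z p ∣)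
      ≤⟨ +-monoʳ-≤ ∣ X p - X q ∣
           (+-monoʳ-≤ ∣ X q - Y q ∣ (∣p-r∣≤∣p-q∣+∣q-r∣ (Y q) (Z q) (Z p))) ⟩
    ∣ X p - X q ∣ + (∣ X q - Y q ∣ + (∣ Y q - Z q ∣ + ∣ Z q - Z p ∣))
      ≤⟨ +-mono-≤ (reg x p q) (+-mono-≤ (x~y j) (+-mono-≤ (y~z j) (reg z q p))) ⟩
    (U + V) + ((a + W) + ((b + W) + (V + U)))
      ≡⟨ regroup a b U V W ⟩
    (a + b) + ((U + U) + ((V + V) + (W + W)))
      ≡⟨ cong (_+_ (a + b)) (regularityBudget i) ⟩
    (a + b) + + 2 / suc i ∎
    where
    open ≤-Reasoning
    X = seq x
    Y = seq y
    Z = seq z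
    j = 4 ℕ.+ 5 ℕ.* i
    p = suc (2 ℕ.* i)
    q = suc (2 ℕ.* j)
    U = + 1 / suc p
    V = + 1 / suc q
    W = + 2 / suc j
    regroup : ∀ a b U V W → (U + V) + ((a + W) + ((b + W) + (V + U))) ≡
                            (a + b) + ((U + U) + ((V + V) + (W + W)))
    regroup = solve 5 (λ a b U V W → (U :+ V) :+ ((a :+ W) :+ ((b :+ W) :+ (V :+ U))) :=
                                     (a :+ b) :+ ((U :+ U) :+ ((V :+ V) :+ (W :+ W)))) refl

  0≤+a/n : ∀ a n .{{_ : NonZero n}} → 0ℚ ≤ + a / n
  0≤+a/n a n = nonNegative⁻¹ (+ a / n) {{normalize-nonNeg a n}}

  ∣p-p∣≤q : ∀ p {q} → 0ℚ ≤ q → ∣ p - p ∣ ≤ q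
  ∣p-p∣≤q p 0≤q = subst (_≤ _) (sym (cong ∣_∣ (+-inverseʳ p))) 0≤q

  DistLe-reflexive : ∀ {x y} k → x ≡ y → DistLe x y (2^- k)
  DistLe-reflexive {x} k refl i =
    ∣p-p∣≤q (seq x (suc (2 ℕ.* i)))
            (+-mono-≤ (0≤+a/n 1 (2 ℕ.^ k) {{m^n≢0 2 k}}) (0≤+a/n 2 (suc i)))

  fromℕ : ℕ → ℝ
  fromℕ m = record
    { seq = λ _ → + m / 1
    ; reg = λ i j → ∣p-p∣≤q (+ m / 1) (+-mono-≤ (0≤+a/n 1 (suc i)) (0≤+a/n 1 (suc j)))
    }

  ∣z∣≤½⇒z≡0 : ∀ z → ℚᵘ.∣ mkℚᵘ z 0 ∣ ℚᵘ.≤ mkℚᵘ (+ 1) 1 → z ≡ + 0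
  ∣z∣≤½⇒z≡0 (+ 0)    _ = refl
  ∣z∣≤½⇒z≡0 +[1+ n ] (ℚᵘ.*≤* (ℤ.+≤+ (ℕ.s≤s ())))
  ∣z∣≤½⇒z≡0 -[1+ n ] (ℚᵘ.*≤* (ℤ.+≤+ (ℕ.s≤s ())))

  ∣m-n∣≤½⇒m≡n : ∀ m n → ∣ + m / 1 - + n / 1 ∣ ≤ + 1 / 2 → m ≡ n
  ∣m-n∣≤½⇒m≡n m n ∣m-n∣≤½ = ℤ.+-injective (ℤ.i-j≡0⇒i≡j (+ m) (+ n) m-n≡0)
    where
    m̂ = mkℚᵘ (+ m) 0
    n̂ = mkℚᵘ (+ n) 0
    toℚᵘ-dist : toℚᵘ ∣ + m / 1 - + n / 1 ∣ ℚᵘ.≃ ℚᵘ.∣ m̂ ℚᵘ.- n̂ ∣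
    toℚᵘ-dist = ℚᵘ.≃-trans (toℚᵘ-homo-∣-∣ (+ m / 1 - + n / 1)) (ℚᵘ.∣-∣-cong
      (ℚᵘ.≃-trans (toℚᵘ-homo-+ (+ m / 1) (- (+ n / 1)))
        (ℚᵘ.+-cong (toℚᵘ-fromℚᵘ m̂)
                   (ℚᵘ.≃-trans (toℚᵘ-homo‿- (+ n / 1)) (ℚᵘ.-‿cong (toℚᵘ-fromℚᵘ n̂))))))
    m-n≡0 : + m ℤ.- + n ≡ + 0
    m-n≡0 = trans (sym (cong₂ ℤ._+_ (ℤ.*-identityʳ (+ m)) (ℤ.*-identityʳ (ℤ.- + n))))
                  (∣z∣≤½⇒z≡0 _ (ℚᵘ.≤-respˡ-≃ toℚᵘ-dist (toℚᵘ-mono-≤ ∣m-n∣≤½)))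

  fromℕ-DistLe-¼⇒≡ : ∀ {m n} → DistLe (fromℕ m) (fromℕ n) (2^- 2) → m ≡ n
  -- At index 7 the bound 2^-2 + 2/8 of DistLe computes to 1/2.
  fromℕ-DistLe-¼⇒≡ {m} {n} d = ∣m-n∣≤½⇒m≡n m n (d 7)

open import Data.Bool using (Bool; true; false)
open import Data.Empty using (⊥-elim)
open import Data.Nat using (ℕ; zero; suc; _≤_; _<_; _⊔_; _≤?_; z≤n; s≤s)
open import Data.Nat.Induction using (<-rec)
open import Data.Nat.Properties
  using (≤-refl; ≤-trans; <-≤-trans; <⇒≤; <-cmp; m≤m⊔n; m≤n⊔m; anyUpTo?)
open import Function using (_∘_)
open import Relation.Binary.Definitions using (tri<; tri≈; tri>)
open import Relation.Nullary using (¬_; yes; no)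
open import Relation.Unary using (Pred; Decidable)

InitEq-weaken : ∀ {m n α β} → m ≤ n → InitEq n α β → InitEq m α β
InitEq-weaken m≤n α≈β i i<m = α≈β i (<-≤-trans i<m m≤n)

InitEq-sym : ∀ {n α β} → InitEq n α β → InitEq n β α
InitEq-sym α≈β i i<n = sym (α≈β i i<n)

InitEq-trans : ∀ {n α β γ} → InitEq n α β → InitEq n β γ → InitEq n α γ
InitEq-trans α≈β β≈γ i i<n = trans (α≈β i i<n) (β≈γ i i<n)

PointwiseContinuousℕ⇒cong : ∀ {g} → PointwiseContinuousℕ g →
                             ∀ {α β} → (∀ i → α i ≡ β i) → g α ≡ g β
PointwiseContinuousℕ⇒cong g-continuous {α} {β} α≗β =
  proj₂ (g-continuous α) β (λ i _ → α≗β i)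

cons : Bool → Cantor → Cantor
cons b α zero    = b
cons b α (suc i) = α i

tail : Cantor → Cantor
tail α i = α (suc i)

-- The point of Cantor space coding the finite sequence ᾱn: α below n, false from n on.
truncate : ℕ → Cantor → Cantor
truncate zero    α _ = false
truncate (suc n) α   = cons (α 0) (truncate n (tail α))

InitEq-truncate : ∀ n α → InitEq n α (truncate n α)
InitEq-truncate (suc n) α zero    _         = refl
InitEq-truncate (suc n) α (suc i) (s≤s i<n) = InitEq-truncate n (tail α) i i<n

truncate-cong : ∀ n {α β} → InitEq n α β → ∀ i → truncate n α i ≡ truncate n β i
truncate-cong zero    α≈β i       = refl
truncate-cong (suc n) α≈β zero    = α≈β 0 (s≤s z≤n)
truncate-cong (suc n) α≈β (suc i) =
  truncate-cong n (λ j j<n → α≈β (suc j) (s≤s j<n)) i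

maxOnTruncations : ℕ → (Cantor → ℕ) → ℕ
maxOnTruncations zero    F = F (λ _ → false)
maxOnTruncations (suc n) F =
  maxOnTruncations n (F ∘ cons false) ⊔ maxOnTruncations n (F ∘ cons true)

≤-maxOnTruncations : ∀ n F α → F (truncate n α) ≤ maxOnTruncations n F
≤-maxOnTruncations zero    F α = ≤-refl
≤-maxOnTruncations (suc n) F α with α 0
... | false = ≤-trans (≤-maxOnTruncations n (F ∘ cons false) (tail α)) (m≤m⊔n _ _)
... | true  = ≤-trans (≤-maxOnTruncations n (F ∘ cons true) (tail α)) (m≤n⊔m _ _)

UniformlyContinuousℕ⇒bounded : ∀ {f} → UniformlyContinuousℕ f → Σ ℕ λ M → ∀ α → f α ≤ M
UniformlyContinuousℕ⇒bounded {f} (n , f-uniform) =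
  maxOnTruncations n f , λ α →
    subst (_≤ maxOnTruncations n f) (sym (f-uniform α (truncate n α) (InitEq-truncate n α)))
          (≤-maxOnTruncations n f α)

Least : Pred ℕ _ → ℕ → Set
Least P n = P n × (∀ {j} → j < n → ¬ P j)

least : ∀ {P} → Decidable P → ∀ {n} → P n → Σ ℕ (Least P)
least {P} P? = <-rec (λ n → P n → Σ ℕ (Least P)) search _
  where
  search : ∀ n → (∀ {m} → m < n → P m → Σ ℕ (Least P)) → P n → Σ ℕ (Least P)
  search n below Pn with anyUpTo? P? n
  ... | yes (m , m<n , Pm) = below m<n Pm
  ... | no  noneBelow      = n , Pn , λ j<n Pj → noneBelow (_ , j<n , Pj)

Least-unique : ∀ {P Q m n} → Least P m → Least Q n →
               (∀ {j} → j ≤ m → P j → Q j) → (∀ {j} → j < m → Q j → P j) → m ≡ n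
Least-unique {m = m} {n} (Pm , P-below) (Qn , Q-below) P⇒Q Q⇒P with <-cmp m n
... | tri< m<n _   _   = ⊥-elim (Q-below m<n (P⇒Q ≤-refl Pm))
... | tri≈ _   m≡n _   = m≡n
... | tri> _   _   n<m = ⊥-elim (P-below n<m (Q⇒P n<m Qn))

module SelfModulus (G : Cantor → ℕ) (G-continuous : PointwiseContinuousℕ G) where

  Fits : Cantor → ℕ → Set
  Fits α n = G (truncate n α) ≤ n

  fits-eventually : ∀ α → Fits α (proj₁ (G-continuous α) ⊔ G α)
  fits-eventually α =
    subst (_≤ n ⊔ G α) (proj₂ (G-continuous α) (truncate (n ⊔ G α) α) α≈truncate)
          (m≤n⊔m n (G α))
    where
    n = proj₁ (G-continuous α)
    α≈truncate : InitEq n α (truncate (n ⊔ G α) α)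
    α≈truncate = InitEq-weaken (m≤m⊔n n (G α)) (InitEq-truncate (n ⊔ G α) α)

  leastFit : ∀ α → Σ ℕ (Least (Fits α))
  leastFit α = least (λ n → G (truncate n α) ≤? n) (fits-eventually α)

  μ : Cantor → ℕ
  μ α = proj₁ (leastFit α)

  fits-μ : ∀ α → Fits α (μ α)
  fits-μ α = proj₁ (proj₂ (leastFit α))

  μ-selfModulus : IsModulusℕ μ μ
  μ-selfModulus α β α≈β =
    Least-unique (proj₂ (leastFit α)) (proj₂ (leastFit β))
      (λ j≤μα → subst (_≤ _) (G-agrees j≤μα))
      (λ j<μα → subst (_≤ _) (sym (G-agrees (<⇒≤ j<μα))))
    where
    G-agrees : ∀ {j} → j ≤ μ α → G (truncate j α) ≡ G (truncate j β)
    G-agrees {j} j≤μα =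
      PointwiseContinuousℕ⇒cong G-continuous (truncate-cong j (InitEq-weaken j≤μα α≈β))

  μ-continuous : PointwiseContinuousℕ μ
  μ-continuous α = μ α , μ-selfModulus α

-- M is a Lebesgue number of the cover of Cantor space by the neighbourhoods
-- {β ∣ InitEq (G γ) γ β}, γ ∈ Cantor.
IsLebesgueNumber : (Cantor → ℕ) → ℕ → Set
IsLebesgueNumber G M =
  ∀ α β → InitEq M α β → Σ Cantor λ γ → InitEq (G γ) γ α × InitEq (G γ) γ β

UCc⇒lebesgueNumber : UCc → ∀ G → PointwiseContinuousℕ G → Σ ℕ (IsLebesgueNumber G)
UCc⇒lebesgueNumber ucc G G-continuous = M , covered
  where
  open SelfModulus G G-continuous
  μ-bounded : Σ ℕ λ M → ∀ α → μ α ≤ M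
  μ-bounded = UniformlyContinuousℕ⇒bounded (ucc μ (μ , μ-selfModulus , μ-continuous))
  M : ℕ
  M = proj₁ μ-bounded

  covered : IsLebesgueNumber G M
  covered α β α≈β = γ , γ≈α , InitEq-trans γ≈α (InitEq-weaken G[γ]≤M α≈β)
    where
    γ = truncate (μ α) α
    γ≈α : InitEq (G γ) γ α
    γ≈α = InitEq-weaken (fits-μ α) (InitEq-sym (InitEq-truncate (μ α) α))
    G[γ]≤M : G γ ≤ M
    G[γ]≤M = ≤-trans (fits-μ α) (proj₂ μ-bounded α)

open BishopDistance
  using (DistLe-sym; DistLe-trans; 2^-suc+2^-suc; DistLe-reflexive; fromℕ; fromℕ-DistLe-¼⇒≡)

sharedCentre⇒DistLe : ∀ {f g} → IsModulusℝ f g → ∀ k {α β} γ →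
                      InitEq (g (suc k) γ) γ α → InitEq (g (suc k) γ) γ β →
                      DistLe (f α) (f β) (2^- k)
sharedCentre⇒DistLe {f} g-modulus k {α} {β} γ γ≈α γ≈β =
  subst (DistLe (f α) (f β)) (2^-suc+2^-suc k)
    (DistLe-trans (f α) (f γ) (f β) ε ε (DistLe-sym (f γ) (f α) ε (g-modulus (suc k) γ α γ≈α))
                                         (g-modulus (suc k) γ β γ≈β))
  where
  ε = 2^- suc k

UCc⇒UCTc : UCc → UCTc
UCc⇒UCTc ucc f _ (g , g-modulus , g-continuous) = ω , ω-uniform
  where
  lebesgue : ∀ k → Σ ℕ (IsLebesgueNumber (g (suc k)))
  lebesgue k = UCc⇒lebesgueNumber ucc (g (suc k)) (g-continuous (suc k))

  ω : ℕ → ℕ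
  ω = proj₁ ∘ lebesgue

  ω-uniform : ∀ k α β → InitEq (ω k) α β → DistLe (f α) (f β) (2^- k)
  ω-uniform k α β α≈β =
    let (γ , γ≈α , γ≈β) = proj₂ (lebesgue k) α β α≈β
    in sharedCentre⇒DistLe {f} g-modulus k γ γ≈α γ≈β

UCTc⇒UCc : UCTc → UCc
UCTc⇒UCc uct f (g , g-modulus , g-continuous) = proj₁ F-uniform 2 , λ α β α≈β →
  fromℕ-DistLe-¼⇒≡ (proj₂ F-uniform 2 α β α≈β)
  where
  F : Cantor → ℝ
  F = fromℕ ∘ f

  F-modulus : IsModulusℝ F (λ _ → g)
  F-modulus k α β α≈β = DistLe-reflexive k (cong fromℕ (g-modulus α β α≈β))

  F-uniform : UniformlyContinuousℝ F
  F-uniform =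
    uct F (λ α k → g α , F-modulus k α) ((λ _ → g) , F-modulus , λ _ → g-continuous)

proposition3p5 : (UCc → UCTc) × (UCTc → UCc)
proposition3p5 = UCc⇒UCTc , UCTc⇒UCc
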